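{- Let $G$ be a graph and $V'\subseteq V(G)$. If there is an induced subgraph $G'$ of $G$ that is a certificate for the oct-minimality of $V'$, then there exists a minimal oct of $G$ containing all vertices of $V'$.
   Context: All graphs are finite, simple and undirected. An oct of $G$ is a set $Z\subseteq V(G)$ with $G-Z$ bipartite; it is minimal if no proper subset is an oct. An induced subgraph $G'$ of $G$ is a certificate for the oct-minimality of $V'$ if $G'$ is bipartite and for every $v\in V'$ the graph $G[V(G')\cup\{v\}]$ contains an odd cycle. -}

module Defs where

open import Data.Bool using (Bool; true; false)
open import Data.Nat using (ℕ; suc; _≥_)
open import Data.Nat.Properties using ()
open import Data.Fin using (Fin)
open import Data.Fin.Subset using (Subset; _∈_; _∉_; _⊆_; _⊂_; _∪_; ⁅_⁆; ∁)
open import Data.List using (List; []; _∷_; length; last)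
open import Data.List.Relation.Unary.All using (All)
open import Data.List.Relation.Unary.AllPairs using (AllPairs)
open import Data.List.Relation.Unary.Linked using (Linked)
open import Data.Maybe using (just)
open import Data.Product using (Σ; _×_; ∃-syntax)
open import Relation.Binary.PropositionalEquality using (_≡_; _≢_)
open import Relation.Nullary using (¬_)

record Graph (n : ℕ) : Set where
  field
    adj    : Fin n → Fin n → Bool
    sym    : ∀ u v → adj u v ≡ adj v u
    irrefl : ∀ v → adj v v ≡ false
open Graph public

Adj : ∀ {n} → Graph n → Fin n → Fin n → Set
Adj G u v = adj G u v ≡ true

BipartiteOn : ∀ {n} → Graph n → Subset n → Set
BipartiteOn {n} G S =
  Σ (Fin n → Bool) λ c → ∀ u v → u ∈ S → v ∈ S → Adj G u v → c u ≢ c v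

data Odd : ℕ → Set where
  one : Odd 1
  ss  : ∀ {k} → Odd k → Odd (suc (suc k))

record OddCycleIn {n} (G : Graph n) (S : Subset n) : Set where
  field
    verts    : List (Fin n)
    inS      : All (_∈ S) verts
    distinct : AllPairs _≢_ verts
    oddLen   : Odd (length verts)
    len≥3    : length verts ≥ 3
    path     : Linked (Adj G) verts
    first    : Fin n
    final    : Fin n
    firstEq  : Data.List.head verts ≡ just first
    finalEq  : last verts ≡ just final
    closing  : Adj G final first

IsOct : ∀ {n} → Graph n → Subset n → Set
IsOct G Z = BipartiteOn G (∁ Z)

IsMinimalOct : ∀ {n} → Graph n → Subset n → Set
IsMinimalOct G Z = IsOct G Z × (∀ Z′ → Z′ ⊂ Z → ¬ IsOct G Z′)

-- The induced subgraph G[W] (W = V(G′)) is a certificate for the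
-- oct-minimality of V′: G[W] is bipartite and for every v ∈ V′,
-- G[W ∪ {v}] contains an odd cycle.
IsCertificate : ∀ {n} → Graph n → Subset n → Subset n → Set
IsCertificate G V′ W =
  BipartiteOn G W × (∀ v → v ∈ V′ → OddCycleIn G (W ∪ ⁅ v ⁆))

{-# OPTIONS --safe #-}
-- Since G[W] is bipartite, ∁ W is an oct; shrink it to a minimal oct Z ⊆ ∁ W.
-- If some v ∈ V′ were missing from Z, then W ∪ {v} would lie in the bipartite
-- graph G - Z, contradicting the odd cycle that the certificate provides in G[W ∪ {v}].
module Submission where

open import Defs hiding (sym)
open import Data.Nat using (ℕ)
open import Data.Bool using (Bool; true)
open import Data.Bool.Properties using (¬-not) renaming (_≟_ to _≟ᵇ_)
open import Data.Fin using (Fin)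
open import Data.Fin.Properties using (all?)
open import Data.Fin.Subset using (Subset; _∈_; _⊆_; _⊂_; _∪_; ⁅_⁆; ∁)
open import Data.Fin.Subset.Induction using (Acc; acc; ⊂-wellFounded)
open import Data.Fin.Subset.Properties
  using (_∈?_; _⊂?_; anySubset?; x∈p∪q⁻; x∈⁅y⁆⇒x≡y; x∈p⇒x∉∁p; x∈∁p⇒x∉p; x∉p⇒x∈∁p; x∉∁p⇒x∈p; p⊆q⇒∁p⊇∁q)
open import Data.List using ([]; _∷_; length; last; head)
open import Data.List.Relation.Unary.All using (All; _∷_)
open import Data.List.Relation.Unary.All.Properties using (head⁺; last⁺)
open import Data.List.Relation.Unary.Linked using (Linked; _∷_)
open import Data.Maybe using (just)
import Data.Maybe.Relation.Unary.All as Maybe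
open import Data.Product using (Σ; _×_; _,_; proj₁)
open import Data.Sum using ([_,_])
open import Data.Vec using (lookup; tabulate)
open import Data.Vec.Properties using (lookup∘tabulate)
open import Function using (_∘_)
open import Relation.Binary.PropositionalEquality using (_≡_; _≢_; refl; sym; trans; subst; subst₂)
open import Relation.Nullary using (¬_; Dec; yes; no; ¬?)
open import Relation.Nullary.Decidable using (_→-dec_; _×-dec_; decidable-stable)
open import Relation.Unary using (Decidable)

private
  variable
    n : ℕ

x∈p⇒x∈∁∁p : {p : Subset n} {x : Fin n} → x ∈ p → x ∈ ∁ (∁ p)
x∈p⇒x∈∁∁p = x∉p⇒x∈∁p ∘ x∈p⇒x∉∁p

x∈∁∁p⇒x∈p : {p : Subset n} {x : Fin n} → x ∈ ∁ (∁ p) → x ∈ p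
x∈∁∁p⇒x∈p = x∉∁p⇒x∈p ∘ x∈∁p⇒x∉p

∪-⊆ : {p q r : Subset n} → p ⊆ r → q ⊆ r → p ∪ q ⊆ r
∪-⊆ {p = p} {q} p⊆r q⊆r x∈p∪q = [ p⊆r , q⊆r ] (x∈p∪q⁻ p q x∈p∪q)

x∈p⇒⁅x⁆⊆p : {p : Subset n} {x : Fin n} → x ∈ p → ⁅ x ⁆ ⊆ p
x∈p⇒⁅x⁆⊆p {p = p} {x} x∈p y∈⁅x⁆ = subst (_∈ p) (sym (x∈⁅y⁆⇒x≡y x y∈⁅x⁆)) x∈p

≢-≢⇒≡ : {a b c : Bool} → a ≢ b → b ≢ c → a ≡ c
≢-≢⇒≡ a≢b b≢c = trans (¬-not a≢b) (sym (¬-not (b≢c ∘ sym)))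

module _ {A : Set} {P : A → Set} where

  All-head : ∀ {x xs} → All P xs → head xs ≡ just x → P x
  All-head Pxs eq = Maybe.drop-just (subst (Maybe.All P) eq (head⁺ Pxs))

  All-last : ∀ {x xs} → All P xs → last xs ≡ just x → P x
  All-last Pxs eq = Maybe.drop-just (subst (Maybe.All P) eq (last⁺ Pxs))

module _ (G : Graph n) where

  ProperColouringOn : Subset n → (Fin n → Bool) → Set
  ProperColouringOn S c = ∀ u v → u ∈ S → v ∈ S → Adj G u v → c u ≢ c v

  properColouringOn? : ∀ S c → Dec (ProperColouringOn S c)
  properColouringOn? S c = all? λ u → all? λ v →
    (u ∈? S) →-dec (v ∈? S) →-dec (adj G u v ≟ᵇ true) →-dec ¬? (c u ≟ᵇ c v)

  -- A colouring Fin n → Bool is tabulated as a Subset n, so anySubset? searches all of them.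
  bipartiteOn? : Decidable (BipartiteOn G)
  bipartiteOn? S with anySubset? (λ s → properColouringOn? S (lookup s))
  ... | yes (s , proper) = yes (lookup s , proper)
  ... | no ∄proper = no λ (c , proper) → ∄proper (tabulate c , λ u v u∈S v∈S u~v →
          subst₂ _≢_ (sym (lookup∘tabulate c u)) (sym (lookup∘tabulate c v)) (proper u v u∈S v∈S u~v))

  bipartiteOn-antimono : {S T : Subset n} → T ⊆ S → BipartiteOn G S → BipartiteOn G T
  bipartiteOn-antimono T⊆S (c , proper) = c , λ u v u∈T v∈T → proper u v (T⊆S u∈T) (T⊆S v∈T)

  -- Colours alternate along a path, so the ends of a path on an odd number of vertices agree.
  oddPath-sameColour : {S : Subset n} {c : Fin n → Bool} → ProperColouringOn S c →
    ∀ {x y} vs → All (_∈ S) vs → Linked (Adj G) vs → Odd (length vs) →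
    head vs ≡ just x → last vs ≡ just y → c x ≡ c y
  oddPath-sameColour proper (_ ∷ []) _ _ one refl refl = refl
  oddPath-sameColour proper (u ∷ v ∷ w ∷ vs)
    (u∈S ∷ v∈S ∷ w∷vs⊆S@(w∈S ∷ _)) (u~v ∷ v~w ∷ path) (ss odd) refl end =
    trans (≢-≢⇒≡ (proper u v u∈S v∈S u~v) (proper v w v∈S w∈S v~w))
          (oddPath-sameColour proper (w ∷ vs) w∷vs⊆S path odd refl end)

  bipartiteOn⇒¬oddCycle : {S : Subset n} → BipartiteOn G S → ¬ OddCycleIn G S
  bipartiteOn⇒¬oddCycle (c , proper) cycle =
    proper final first (All-last inS finalEq) (All-head inS firstEq) closing
      (sym (oddPath-sameColour proper verts inS path oddLen firstEq finalEq))
    where open OddCycleIn cycle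

  minimalOct⊆ : ∀ Z → IsOct G Z → Σ (Subset n) λ Z* → IsMinimalOct G Z* × Z* ⊆ Z
  minimalOct⊆ Z = go Z (⊂-wellFounded Z)
    where
    go : ∀ Z → Acc _⊂_ Z → IsOct G Z → Σ (Subset n) λ Z* → IsMinimalOct G Z* × Z* ⊆ Z
    go Z (acc smaller) oct with anySubset? (λ Z′ → Z′ ⊂? Z ×-dec bipartiteOn? (∁ Z′))
    ... | yes (Z′ , Z′⊂Z , oct′) =
      let Z* , minimal , Z*⊆Z′ = go Z′ (smaller Z′⊂Z) oct′
      in Z* , minimal , proj₁ Z′⊂Z ∘ Z*⊆Z′
    ... | no ∄smallerOct = Z , (oct , λ Z′ Z′⊂Z oct′ → ∄smallerOct (Z′ , Z′⊂Z , oct′)) , λ x∈Z → x∈Z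

  certified⊆oct : ∀ {V′ W Z} → IsCertificate G V′ W → IsOct G Z → Z ⊆ ∁ W → V′ ⊆ Z
  certified⊆oct {W = W} {Z} (_ , oddCycle) oct Z⊆∁W {v} v∈V′ =
    decidable-stable (v ∈? Z) λ v∉Z →
      bipartiteOn⇒¬oddCycle
        (bipartiteOn-antimono (∪-⊆ W⊆∁Z (x∈p⇒⁅x⁆⊆p (x∉p⇒x∈∁p v∉Z))) oct)
        (oddCycle v v∈V′)
    where
    W⊆∁Z : W ⊆ ∁ Z
    W⊆∁Z = p⊆q⇒∁p⊇∁q Z⊆∁W ∘ x∈p⇒x∈∁∁p

lemma15 : ∀ {n} (G : Graph n) (V′ : Subset n) →
    Σ (Subset n) (λ W → IsCertificate G V′ W) →
    Σ (Subset n) (λ Z → IsMinimalOct G Z × V′ ⊆ Z)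
lemma15 G V′ (W , certificate@(bipartiteW , _)) =
  let Z , minimal@(oct , _) , Z⊆∁W = minimalOct⊆ G (∁ W) (bipartiteOn-antimono G x∈∁∁p⇒x∈p bipartiteW)
  in  Z , minimal , certified⊆oct G certificate oct Z⊆∁W
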